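{- Let $G$ be a finite simple graph. Then $m(G) = 2^{\beta(G)}$ if and only if $G$ is a bipartite Cameron-Walker graph, i.e. $G$ is bipartite and $\nu(G)=\nu_0(G)$.
   Context: For a finite simple graph $G$, $m(G)$ denotes the number of maximal independent sets of $G$ (a graph with no edges, including the graph with no vertices, has $m(G)=1$). A vertex cover of $G$ is a set $C\subseteq V(G)$ such that every edge has at least one endpoint in $C$; $\beta(G)$ is the minimum size of a vertex cover. A matching is a set of pairwise disjoint edges; $\nu(G)$ is the maximum size of a matching. An induced matching is a matching $M$ such that no two edges of $M$ are joined by an edge of $G$; $\nu_0(G)$ is the maximum size of an induced matching. $G$ is called a Cameron-Walker graph if $\nu(G)=\nu_0(G)$. -}

module Defs where

open import Level using (0ℓ)
open import Data.Nat using (ℕ; zero; suc; _≤_)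
open import Data.Bool using (Bool)
open import Data.Fin using (Fin)
open import Data.Fin.Subset using (Subset; _∈_; _∉_; _⊆_; ∣_∣; inside; outside)
open import Data.Fin.Subset.Properties using (_∈?_; _⊆?_; anySubset?)
open import Data.Fin.Properties using (all?)
open import Data.Vec using (_∷_; [])
open import Data.List using (List; []; _∷_; _++_; map; filter; length)
open import Data.Sum using (_⊎_)
open import Data.Product using (Σ; ∃; _×_; _,_; proj₁; proj₂)
open import Relation.Nullary using (¬_; Dec; yes; no)
open import Relation.Nullary.Decidable using (_×-dec_; _→-dec_; ¬?; decidable-stable)
open import Relation.Binary using (Rel; Decidable)
open import Relation.Binary.PropositionalEquality using (_≡_; _≢_)

record Graph (n : ℕ) : Set₁ where
  field
    Adj    : Rel (Fin n) 0ℓ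
    adj?   : Decidable Adj
    sym    : ∀ {u v} → Adj u v → Adj v u
    irrefl : ∀ {u} → ¬ Adj u u

module _ {n : ℕ} (G : Graph n) where
  open Graph G

  Independent : Subset n → Set
  Independent S = ∀ u v → u ∈ S → v ∈ S → ¬ Adj u v

  MaximalIndependent : Subset n → Set
  MaximalIndependent S =
    Independent S × (∀ T → Independent T → S ⊆ T → T ⊆ S)

  independent? : (S : Subset n) → Dec (Independent S)
  independent? S =
    all? λ u → all? λ v → (u ∈? S) →-dec ((v ∈? S) →-dec ¬? (adj? u v))

  private
    Bad : Subset n → Subset n → Set
    Bad S T = ¬ (Independent T → S ⊆ T → T ⊆ S)

    bad? : ∀ S T → Dec (Bad S T)
    bad? S T = ¬? (independent? T →-dec ((S ⊆? T) →-dec (T ⊆? S)))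

    good? : ∀ S T → Dec (Independent T → S ⊆ T → T ⊆ S)
    good? S T = independent? T →-dec ((S ⊆? T) →-dec (T ⊆? S))

  maximalIndependent? : (S : Subset n) → Dec (MaximalIndependent S)
  maximalIndependent? S with independent? S | anySubset? (bad? S)
  ... | no ¬i | _ = no λ m → ¬i (proj₁ m)
  ... | yes i | yes (T , b) = no λ m → b (proj₂ m T)
  ... | yes i | no ¬b = yes (i , λ T → decidable-stable (good? S T) (λ ng → ¬b (T , ng)))

allSubsets : (n : ℕ) → List (Subset n)
allSubsets zero    = [] ∷ []
allSubsets (suc n) = map (inside ∷_) (allSubsets n) ++ map (outside ∷_) (allSubsets n)

mis : ∀ {n} → Graph n → ℕ
mis {n} G = length (filter (maximalIndependent? G) (allSubsets n))

module _ {n : ℕ} (G : Graph n) where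
  open Graph G

  VertexCover : Subset n → Set
  VertexCover C = ∀ u v → Adj u v → u ∈ C ⊎ v ∈ C

  IsVertexCoverNumber : ℕ → Set
  IsVertexCoverNumber b =
    (Σ (Subset n) λ C → VertexCover C × ∣ C ∣ ≡ b) × (∀ C → VertexCover C → b ≤ ∣ C ∣)

  Endpoint : Fin n → Fin n × Fin n → Set
  Endpoint w e = w ≡ proj₁ e ⊎ w ≡ proj₂ e

  IsMatching : (k : ℕ) → (Fin k → Fin n × Fin n) → Set
  IsMatching k e =
    (∀ i → Adj (proj₁ (e i)) (proj₂ (e i))) ×
    (∀ i j → i ≢ j → ∀ w → Endpoint w (e i) → ¬ Endpoint w (e j))

  IsInducedMatching : (k : ℕ) → (Fin k → Fin n × Fin n) → Set
  IsInducedMatching k e =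
    IsMatching k e ×
    (∀ i j → i ≢ j → ∀ x y → Endpoint x (e i) → Endpoint y (e j) → ¬ Adj x y)

  IsMatchingNumber : ℕ → Set
  IsMatchingNumber k =
    (Σ (Fin k → Fin n × Fin n) (IsMatching k)) ×
    (∀ j (e : Fin j → Fin n × Fin n) → IsMatching j e → j ≤ k)

  IsInducedMatchingNumber : ℕ → Set
  IsInducedMatchingNumber k =
    (Σ (Fin k → Fin n × Fin n) (IsInducedMatching k)) ×
    (∀ j (e : Fin j → Fin n × Fin n) → IsInducedMatching j e → j ≤ k)

  Bipartite : Set
  Bipartite = Σ (Fin n → Bool) λ c → ∀ u v → Adj u v → c u ≢ c v

  CameronWalker : Set
  CameronWalker = ∀ a b → IsMatchingNumber a → IsInducedMatchingNumber b → a ≡ b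

-- Fix a minimum vertex cover C. A maximal independent set S is determined by S ∩ C: it
-- consists of S ∩ C and the vertices outside C without a neighbour there. Hence
-- m(G) ≤ 2^β(G), with equality iff every A ⊆ C extends to a maximal independent set,
-- iff C is independent and every c ∈ C has a private neighbour outside C. Then G is
-- bipartite with sides C and its complement, and the edges from C to the private
-- neighbours form an induced matching of size β(G) ≥ ν(G), so ν(G) = ν₀(G).
-- Conversely, let G be bipartite with ν(G) = ν₀(G) and take an induced maximum matching.
-- Each of its edges pq can be oriented so that all neighbours of q are matched: otherwise
-- p and q have unmatched neighbours, equal ones close a triangle and distinct ones give an
-- augmenting path. The first ends then form an independent vertex cover with private
-- neighbours, which is therefore minimum, and m(G) = 2^β(G).

module Submission where

open import Defs
open import Level using (0ℓ)
open import Data.Bool using (not)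
open import Data.Bool.Properties using (¬-not; not-involutive)
open import Data.Empty using (⊥; ⊥-elim)
open import Data.Fin using (Fin; zero; suc)
open import Data.Fin.Properties using (_≟_; any?; all?; injective⇒≤; suc-injective)
open import Data.Fin.Subset
  using (Subset; inside; outside; ∣_∣; _∈_; _∉_; _⊆_; _∩_; _∪_; _-_; ⁅_⁆; ⊤)
open import Data.Fin.Subset.Properties
  using (_∈?_; ⊆-antisym; drop-∷-⊆; out⊆; in⊆in; x∈p∩q⁺; x∈p∩q⁻; x∈p∪q⁺; x∈p∪q⁻;
         x∈⁅x⁆; x∈⁅y⁆⇒x≡y; p⊆p∪q; x∈p∧x≢y⇒x∈p-y; x∈p⇒∣p-x∣<∣p∣; ∈⊤; ∣⊤∣≡n)
open import Data.List using (List; []; _∷_; _++_; map; filter; length; lookup)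
open import Data.List.Properties using (length-++; length-map; filter-all; filter-complete)
open import Data.List.Membership.Propositional using () renaming (_∈_ to _∈ˡ_)
open import Data.List.Membership.Propositional.Properties
  using (∈-map⁺; ∈-map⁻; ∈-++⁺ˡ; ∈-++⁺ʳ; ∈-++⁻; ∈-filter⁺; ∈-filter⁻; ∈-lookup)
open import Data.List.Relation.Unary.All using (All)
import Data.List.Relation.Unary.All as All
open import Data.List.Relation.Unary.All.Properties using (all-filter)
open import Data.List.Relation.Unary.Any using (here; there; index)
open import Data.List.Relation.Unary.Any.Properties using (lookup-index)
open import Data.List.Relation.Unary.AllPairs using ([]; _∷_)
open import Data.List.Relation.Unary.Unique.Propositional using (Unique)
import Data.List.Relation.Unary.Unique.Propositional.Properties as Unique
open import Data.Nat using (ℕ; zero; suc; _+_; _^_; _≤_; z≤n; s≤s; s≤s⁻¹)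
open import Data.Nat.Properties using (≤-antisym; ≤-trans; ≤∧≢⇒<; +-identityʳ; 1+n≰n)
import Data.Nat.Properties as ℕ
open import Data.Product using (Σ; ∃-syntax; _×_; _,_; proj₁; proj₂; swap; uncurry′)
open import Data.Sum using (_⊎_; inj₁; inj₂; [_,_])
open import Data.Vec using ([]; _∷_; here; there; tabulate)
import Data.Vec.Functional as VF
open import Data.Vec.Functional using (updateAt)
open import Data.Vec.Functional.Properties using (updateAt-updates; updateAt-minimal)
open import Data.Vec.Properties using (∷-injectiveʳ; lookup∘tabulate; []=⇒lookup; lookup⇒[]=)
open import Function using (_∘_; const)
open import Function.Bundles using (_⇔_; mk⇔; Equivalence)
open import Relation.Nullary using (¬_; Dec; yes; no; does; contradiction)
open import Relation.Nullary.Decidable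
  using (_×-dec_; _⊎-dec_; _→-dec_; ¬?; decidable-stable; ¬¬-excluded-middle; dec-true)
open import Relation.Nullary.Negation using (¬¬-map)
open import Relation.Unary using (Pred; Decidable)
open import Relation.Binary.PropositionalEquality
  using (_≡_; _≢_; refl; sym; trans; cong; cong₂; subst; module ≡-Reasoning)

lookup-injective : ∀ {A : Set} {xs : List A} → Unique xs →
  ∀ {i j} → lookup xs i ≡ lookup xs j → i ≡ j
lookup-injective {xs = _ ∷ _} (_   ∷ _)  {zero}  {zero}  _  = refl
lookup-injective {xs = _ ∷ _} (x∉ ∷ _)   {zero}  {suc j} eq =
  contradiction eq (All.lookup x∉ (∈-lookup j))
lookup-injective {xs = _ ∷ _} (x∉ ∷ _)   {suc i} {zero}  eq =
  contradiction (sym eq) (All.lookup x∉ (∈-lookup i))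
lookup-injective {xs = _ ∷ _} (_  ∷ xs!) {suc i} {suc j} eq = cong suc (lookup-injective xs! eq)

module _ {A B : Set} {P : Pred A 0ℓ} {Q : Pred B 0ℓ} (P? : Decidable P) (Q? : Decidable Q) where

  count-≤-retraction : (f : A → B) (g : B → A) {xs : List A} {ys : List B} → Unique xs →
    (∀ {x} → x ∈ˡ xs → P x → f x ∈ˡ ys × Q (f x)) →
    (∀ {x} → x ∈ˡ xs → P x → g (f x) ≡ x) →
    length (filter P? xs) ≤ length (filter Q? ys)
  count-≤-retraction f g {xs} {ys} xs! f-into g∘f≡id = injective⇒≤ position-injective
    where
    member : ∀ i → lookup (filter P? xs) i ∈ˡ xs × P (lookup (filter P? xs) i)
    member i = ∈-filter⁻ P? (∈-lookup i)

    image : ∀ i → f (lookup (filter P? xs) i) ∈ˡ filter Q? ys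
    image i = let (x∈ , Px) = member i ; (fx∈ , Qfx) = f-into x∈ Px in ∈-filter⁺ Q? fx∈ Qfx

    position : Fin (length (filter P? xs)) → Fin (length (filter Q? ys))
    position i = index (image i)

    position-injective : ∀ {i j} → position i ≡ position j → i ≡ j
    position-injective {i} {j} eq = lookup-injective (Unique.filter⁺ P? xs!) (begin
      lookup (filter P? xs) i         ≡⟨ sym (uncurry′ g∘f≡id (member i)) ⟩
      g (f (lookup (filter P? xs) i)) ≡⟨ cong g (lookup-index (image i)) ⟩
      g (lookup (filter Q? ys) (position i)) ≡⟨ cong (g ∘ lookup (filter Q? ys)) eq ⟩
      g (lookup (filter Q? ys) (position j)) ≡⟨ cong g (sym (lookup-index (image j))) ⟩
      g (f (lookup (filter P? xs) j)) ≡⟨ uncurry′ g∘f≡id (member j) ⟩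
      lookup (filter P? xs) j         ∎)
      where
      open ≡-Reasoning

module _ {A B : Set} {P : Pred A 0ℓ} {Q : Pred B 0ℓ} (P? : Decidable P) (Q? : Decidable Q) where

  count-≡-bijection : (f : A → B) (g : B → A) {xs : List A} {ys : List B} →
    Unique xs → Unique ys →
    (∀ {x} → x ∈ˡ xs → P x → f x ∈ˡ ys × Q (f x)) →
    (∀ {y} → y ∈ˡ ys → Q y → g y ∈ˡ xs × P (g y)) →
    (∀ {x} → x ∈ˡ xs → P x → g (f x) ≡ x) →
    (∀ {y} → y ∈ˡ ys → Q y → f (g y) ≡ y) →
    length (filter P? xs) ≡ length (filter Q? ys)
  count-≡-bijection f g xs! ys! f-into g-into g∘f≡id f∘g≡id = ≤-antisym
    (count-≤-retraction P? Q? f g xs! f-into g∘f≡id)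
    (count-≤-retraction Q? P? g f ys! g-into f∘g≡id)

subsetsOf : ∀ {n} → Subset n → List (Subset n)
subsetsOf []            = [] ∷ []
subsetsOf (inside ∷ C)  = map (inside ∷_) (subsetsOf C) ++ map (outside ∷_) (subsetsOf C)
subsetsOf (outside ∷ C) = map (outside ∷_) (subsetsOf C)

length-subsetsOf : ∀ {n} (C : Subset n) → length (subsetsOf C) ≡ 2 ^ ∣ C ∣
length-subsetsOf [] = refl
length-subsetsOf (inside ∷ C) = begin
  length (map (inside ∷_) (subsetsOf C) ++ map (outside ∷_) (subsetsOf C))
    ≡⟨ length-++ (map (inside ∷_) (subsetsOf C)) ⟩
  length (map (inside ∷_) (subsetsOf C)) + length (map (outside ∷_) (subsetsOf C))
    ≡⟨ cong₂ _+_ (length-map _ (subsetsOf C)) (length-map _ (subsetsOf C)) ⟩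
  length (subsetsOf C) + length (subsetsOf C)
    ≡⟨ cong (λ m → m + m) (length-subsetsOf C) ⟩
  2 ^ ∣ C ∣ + 2 ^ ∣ C ∣
    ≡⟨ cong (2 ^ ∣ C ∣ +_) (sym (+-identityʳ (2 ^ ∣ C ∣))) ⟩
  2 ^ suc ∣ C ∣ ∎
  where open ≡-Reasoning
length-subsetsOf (outside ∷ C) = trans (length-map _ (subsetsOf C)) (length-subsetsOf C)

subsetsOf-unique : ∀ {n} (C : Subset n) → Unique (subsetsOf C)
subsetsOf-unique []            = All.[] ∷ []
subsetsOf-unique (outside ∷ C) = Unique.map⁺ ∷-injectiveʳ (subsetsOf-unique C)
subsetsOf-unique (inside ∷ C)  = Unique.++⁺
  (Unique.map⁺ ∷-injectiveʳ (subsetsOf-unique C))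
  (Unique.map⁺ ∷-injectiveʳ (subsetsOf-unique C))
  heads-differ
  where
  heads-differ : ∀ {A} →
    ¬ (A ∈ˡ map (inside ∷_) (subsetsOf C) × A ∈ˡ map (outside ∷_) (subsetsOf C))
  heads-differ (A∈ , A∈′) with ∈-map⁻ (inside ∷_) A∈ | ∈-map⁻ (outside ∷_) A∈′
  ... | _ , _ , refl | _ , _ , ()

∈-subsetsOf⁺ : ∀ {n} {A C : Subset n} → A ⊆ C → A ∈ˡ subsetsOf C
∈-subsetsOf⁺ {A = []}          {[]}          _   = here refl
∈-subsetsOf⁺ {A = inside ∷ A}  {inside ∷ C}  A⊆C =
  ∈-++⁺ˡ (∈-map⁺ (inside ∷_) (∈-subsetsOf⁺ (drop-∷-⊆ A⊆C)))
∈-subsetsOf⁺ {A = outside ∷ A} {inside ∷ C}  A⊆C =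
  ∈-++⁺ʳ (map (inside ∷_) (subsetsOf C)) (∈-map⁺ (outside ∷_) (∈-subsetsOf⁺ (drop-∷-⊆ A⊆C)))
∈-subsetsOf⁺ {A = outside ∷ A} {outside ∷ C} A⊆C = ∈-map⁺ (outside ∷_) (∈-subsetsOf⁺ (drop-∷-⊆ A⊆C))
∈-subsetsOf⁺ {A = inside ∷ A}  {outside ∷ C} A⊆C with () ← A⊆C here

∈-subsetsOf⁻ : ∀ {n} {A C : Subset n} → A ∈ˡ subsetsOf C → A ⊆ C
∈-subsetsOf⁻ {C = []}          (here refl) = λ ()
∈-subsetsOf⁻ {C = outside ∷ C} A∈ with ∈-map⁻ (outside ∷_) A∈
... | _ , A∈′ , refl = out⊆ (∈-subsetsOf⁻ A∈′)
∈-subsetsOf⁻ {C = inside ∷ C}  A∈ with ∈-++⁻ (map (inside ∷_) (subsetsOf C)) A∈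
... | inj₁ A∈ᵢ with ∈-map⁻ (inside ∷_) A∈ᵢ
...   | _ , A∈′ , refl = in⊆in (∈-subsetsOf⁻ A∈′)
∈-subsetsOf⁻ {C = inside ∷ C}  A∈ | inj₂ A∈ₒ with ∈-map⁻ (outside ∷_) A∈ₒ
...   | _ , A∈′ , refl = out⊆ (∈-subsetsOf⁻ A∈′)

allSubsets≡subsetsOf⊤ : ∀ n → allSubsets n ≡ subsetsOf (⊤ {n})
allSubsets≡subsetsOf⊤ zero    = refl
allSubsets≡subsetsOf⊤ (suc n) rewrite allSubsets≡subsetsOf⊤ n = refl

allSubsets-unique : ∀ n → Unique (allSubsets n)
allSubsets-unique n rewrite allSubsets≡subsetsOf⊤ n = subsetsOf-unique ⊤

∈-allSubsets : ∀ {n} (S : Subset n) → S ∈ˡ allSubsets n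
∈-allSubsets {n} S rewrite allSubsets≡subsetsOf⊤ n = ∈-subsetsOf⁺ (λ _ → ∈⊤)

module _ {n : ℕ} {P : Pred (Fin n) 0ℓ} (P? : Decidable P) where

  subset : Subset n
  subset = tabulate (does ∘ P?)

  ∈-subset⁺ : ∀ {x} → P x → x ∈ subset
  ∈-subset⁺ {x} Px = lookup⇒[]= x subset (trans (lookup∘tabulate (does ∘ P?) x) (dec-true (P? x) Px))

  ∈-subset⁻ : ∀ {x} → x ∈ subset → P x
  ∈-subset⁻ {x} x∈ with P? x | trans (sym (lookup∘tabulate (does ∘ P?) x)) ([]=⇒lookup x∈)
  ... | yes Px | _  = Px
  ... | no _   | ()

injective⇒≤∣∣ : ∀ {n j} {D : Subset n} (f : Fin j → Fin n) →
  (∀ {i i′} → f i ≡ f i′ → i ≡ i′) → (∀ i → f i ∈ D) → j ≤ ∣ D ∣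
injective⇒≤∣∣ {j = zero}  f f-inj f∈D = z≤n
injective⇒≤∣∣ {j = suc j} {D} f f-inj f∈D = ≤-trans
  (s≤s (injective⇒≤∣∣ {D = D - f zero} (f ∘ suc) (suc-injective ∘ f-inj)
    (λ i → x∈p∧x≢y⇒x∈p-y (f∈D (suc i)) (λ eq → contradiction (f-inj eq) λ ()))))
  (x∈p⇒∣p-x∣<∣p∣ (f∈D zero))

enumerate : ∀ {n} (D : Subset n) → Fin ∣ D ∣ → Fin n
enumerate (inside ∷ D)  zero    = zero
enumerate (inside ∷ D)  (suc i) = suc (enumerate D i)
enumerate (outside ∷ D) i       = suc (enumerate D i)

enumerate-∈ : ∀ {n} (D : Subset n) i → enumerate D i ∈ D
enumerate-∈ (inside ∷ D)  zero    = here
enumerate-∈ (inside ∷ D)  (suc i) = there (enumerate-∈ D i)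
enumerate-∈ (outside ∷ D) i       = there (enumerate-∈ D i)

enumerate-injective : ∀ {n} (D : Subset n) {i j} → enumerate D i ≡ enumerate D j → i ≡ j
enumerate-injective (inside ∷ D)  {zero}  {zero}  _  = refl
enumerate-injective (inside ∷ D)  {suc i} {suc j} eq = cong suc (enumerate-injective D (suc-injective eq))
enumerate-injective (outside ∷ D) eq = enumerate-injective D (suc-injective eq)

¬¬-maximum : (P : ℕ → Set) → P 0 → ∀ N → (∀ j → P j → j ≤ N) →
  ¬ ¬ (∃[ k ] P k × (∀ j → P j → j ≤ k))
¬¬-maximum P P0 zero    bounded no-max = no-max (0 , P0 , bounded)
¬¬-maximum P P0 (suc N) bounded no-max = ¬¬-excluded-middle λ where
  (yes PN) → no-max (suc N , PN , bounded)
  (no ¬PN) → ¬¬-maximum P P0 N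
    (λ j Pj → s≤s⁻¹ (≤∧≢⇒< (bounded j Pj) (λ { refl → ¬PN Pj }))) no-max

module _ {n : ℕ} (G : Graph n) where
  open Graph G renaming (sym to adj-sym)

  Touch : Fin n → Fin n → Set
  Touch x y = x ≡ y ⊎ Adj x y

  Dominating : Subset n → Set
  Dominating S = ∀ v → v ∉ S → ∃[ u ] u ∈ S × Adj v u

  maximal⇒dominating : ∀ {S} → MaximalIndependent G S → Dominating S
  maximal⇒dominating {S} (S-indep , S-maximal) v v∉S =
    decidable-stable (any? λ u → (u ∈? S) ×-dec adj? v u) λ no-neighbour →
      v∉S (S-maximal (S ∪ ⁅ v ⁆) (S+v-independent no-neighbour)
        (p⊆p∪q ⁅ v ⁆) (x∈p∪q⁺ (inj₂ (x∈⁅x⁆ v))))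
    where
    S+v-independent : ¬ (∃[ u ] u ∈ S × Adj v u) → Independent G (S ∪ ⁅ v ⁆)
    S+v-independent no-neighbour x y x∈ y∈ xy with x∈p∪q⁻ S ⁅ v ⁆ x∈ | x∈p∪q⁻ S ⁅ v ⁆ y∈
    ... | inj₁ x∈S | inj₁ y∈S = S-indep x y x∈S y∈S xy
    ... | inj₁ x∈S | inj₂ y∈v with refl ← x∈⁅y⁆⇒x≡y v y∈v = no-neighbour (x , x∈S , adj-sym xy)
    ... | inj₂ x∈v | inj₁ y∈S with refl ← x∈⁅y⁆⇒x≡y v x∈v = no-neighbour (y , y∈S , xy)
    ... | inj₂ x∈v | inj₂ y∈v
      with refl ← x∈⁅y⁆⇒x≡y v x∈v | refl ← x∈⁅y⁆⇒x≡y v y∈v = irrefl xy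

  independent∧dominating⇒maximal : ∀ {S} → Independent G S → Dominating S → MaximalIndependent G S
  independent∧dominating⇒maximal {S} S-indep S-dom = S-indep , λ T T-indep S⊆T {v} v∈T →
    decidable-stable (v ∈? S) λ v∉S →
      let (u , u∈S , vu) = S-dom v v∉S in T-indep v u v∈T (S⊆T u∈S) vu

  Covered : ∀ {k} → (Fin k → Fin n × Fin n) → Fin n → Set
  Covered e w = ∃[ i ] Endpoint G w (e i)

  endpoint? : ∀ w e → Dec (Endpoint G w e)
  endpoint? w (x , y) = (w ≟ x) ⊎-dec (w ≟ y)

  covered? : ∀ {k} (e : Fin k → Fin n × Fin n) → Decidable (Covered e)
  covered? e w = any? λ i → endpoint? w (e i)

  MatchingsAtMost : ℕ → Set
  MatchingsAtMost k = ∀ j f → IsMatching G j f → j ≤ k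

  InducedMaximumMatching : Set
  InducedMaximumMatching =
    ∃[ k ] Σ (Fin k → Fin n × Fin n) λ e → IsInducedMatching G k e × MatchingsAtMost k

  module _ {k : ℕ} {e : Fin k → Fin n × Fin n} where

    shared-endpoint⇒same-edge : IsMatching G k e →
      ∀ {i j w} → Endpoint G w (e i) → Endpoint G w (e j) → i ≡ j
    shared-endpoint⇒same-edge (_ , disjoint) {i} {j} {w} w∈i w∈j =
      decidable-stable (i ≟ j) λ i≢j → disjoint i j i≢j w w∈i w∈j

    touching⇒same-edge : IsInducedMatching G k e →
      ∀ {i j x y} → Endpoint G x (e i) → Endpoint G y (e j) → Touch x y → i ≡ j
    touching⇒same-edge (matching , _) x∈i y∈j (inj₁ refl) = shared-endpoint⇒same-edge matching x∈i y∈j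
    touching⇒same-edge (_ , induced) {i} {j} {x} {y} x∈i y∈j (inj₂ xy) =
      decidable-stable (i ≟ j) λ i≢j → induced i j i≢j x y x∈i y∈j xy

    inducedMatching-intro : (∀ i → Adj (proj₁ (e i)) (proj₂ (e i))) →
      (∀ {i j x y} → Endpoint G x (e i) → Endpoint G y (e j) → Touch x y → i ≡ j) →
      IsInducedMatching G k e
    inducedMatching-intro edges touch⇒same =
      (edges , λ i j i≢j w w∈i w∈j → i≢j (touch⇒same w∈i w∈j (inj₁ refl))) ,
      λ i j i≢j x y x∈i y∈j xy → i≢j (touch⇒same x∈i y∈j (inj₂ xy))

    matching≤cover : IsMatching G k e → ∀ {D} → VertexCover G D → k ≤ ∣ D ∣
    matching≤cover matching@(edges , _) {D} D-cover =
      injective⇒≤∣∣ (proj₁ ∘ coveredEnd) coveredEnd-injective (proj₂ ∘ proj₂ ∘ coveredEnd)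
      where
      coveredEnd : ∀ i → ∃[ w ] Endpoint G w (e i) × w ∈ D
      coveredEnd i = [ (λ x∈D → _ , inj₁ refl , x∈D) , (λ y∈D → _ , inj₂ refl , y∈D) ]
        (D-cover _ _ (edges i))

      coveredEnd-injective : ∀ {i j} → proj₁ (coveredEnd i) ≡ proj₁ (coveredEnd j) → i ≡ j
      coveredEnd-injective {i} {j} eq = shared-endpoint⇒same-edge matching
        (proj₁ (proj₂ (coveredEnd i)))
        (subst (λ w → Endpoint G w (e j)) (sym eq) (proj₁ (proj₂ (coveredEnd j))))

  -- The only candidate for a maximal independent set S with S ∩ C = A: add to A every
  -- vertex outside C that has no neighbour in A.
  InExtension : Subset n → Subset n → Fin n → Set
  InExtension C A v = (v ∈ C × v ∈ A) ⊎ (v ∉ C × (∀ u → u ∈ A → ¬ Adj v u))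

  inExtension? : ∀ C A → Decidable (InExtension C A)
  inExtension? C A v = ((v ∈? C) ×-dec (v ∈? A)) ⊎-dec
    (¬? (v ∈? C) ×-dec all? λ u → (u ∈? A) →-dec ¬? (adj? v u))

  extension : Subset n → Subset n → Subset n
  extension C A = subset (inExtension? C A)

  ExtendsEverySubset : Subset n → Set
  ExtendsEverySubset C = ∀ A → A ⊆ C → MaximalIndependent G (extension C A)

  extension[A]∩C≡A : ∀ {C A} → A ⊆ C → extension C A ∩ C ≡ A
  extension[A]∩C≡A {C} {A} A⊆C = ⊆-antisym
    (λ v∈ → let (v∈E , v∈C) = x∈p∩q⁻ (extension C A) C v∈ in
      [ proj₂ , (λ (v∉C , _) → contradiction v∈C v∉C) ] (∈-subset⁻ (inExtension? C A) v∈E))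
    (λ v∈A → x∈p∩q⁺ (∈-subset⁺ (inExtension? C A) (inj₁ (A⊆C v∈A , v∈A)) , A⊆C v∈A))

  module _ {C : Subset n} (C-cover : VertexCover G C) where

    extension[S∩C]≡S : ∀ {S} → MaximalIndependent G S → extension C (S ∩ C) ≡ S
    extension[S∩C]≡S {S} S-max@(S-indep , _) = ⊆-antisym extension⊆S S⊆extension
      where
      S⊆extension : S ⊆ extension C (S ∩ C)
      S⊆extension {v} v∈S = ∈-subset⁺ (inExtension? C (S ∩ C)) (case (v ∈? C))
        where
        case : Dec (v ∈ C) → InExtension C (S ∩ C) v
        case (yes v∈C) = inj₁ (v∈C , x∈p∩q⁺ (v∈S , v∈C))
        case (no v∉C)  = inj₂ (v∉C , λ u u∈ → S-indep v u v∈S (proj₁ (x∈p∩q⁻ S C u∈)))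

      extension⊆S : extension C (S ∩ C) ⊆ S
      extension⊆S {v} v∈E with ∈-subset⁻ (inExtension? C (S ∩ C)) v∈E
      ... | inj₁ (_ , v∈S∩C)         = proj₁ (x∈p∩q⁻ S C v∈S∩C)
      ... | inj₂ (v∉C , no-neighbour) = decidable-stable (v ∈? S) λ v∉S →
        let (u , u∈S , vu) = maximal⇒dominating S-max v v∉S
            u∈C = [ (λ v∈C → contradiction v∈C v∉C) , (λ u∈C → u∈C) ] (C-cover v u vu)
        in no-neighbour u (x∈p∩q⁺ (u∈S , u∈C)) vu

    mis≡#extendable : mis G ≡ length (filter (maximalIndependent? G ∘ extension C) (subsetsOf C))
    mis≡#extendable = count-≡-bijection (maximalIndependent? G) (maximalIndependent? G ∘ extension C)
      (_∩ C) (extension C)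
      (allSubsets-unique n) (subsetsOf-unique C)
      (λ {S} _ S-max → ∈-subsetsOf⁺ (λ v∈ → proj₂ (x∈p∩q⁻ S C v∈)) ,
                       subst (MaximalIndependent G) (sym (extension[S∩C]≡S S-max)) S-max)
      (λ {A} _ E-max → ∈-allSubsets (extension C A) , E-max)
      (λ _ S-max → extension[S∩C]≡S S-max)
      (λ A∈ _ → extension[A]∩C≡A (∈-subsetsOf⁻ A∈))

    mis≡2^∣C∣⇔extendsEverySubset : (mis G ≡ 2 ^ ∣ C ∣) ⇔ ExtendsEverySubset C
    mis≡2^∣C∣⇔extendsEverySubset = mk⇔ to from
      where
      open ≡-Reasoning
      subsets : List (Subset n)
      subsets = subsetsOf C

      extendable? : Decidable (MaximalIndependent G ∘ extension C)
      extendable? = maximalIndependent? G ∘ extension C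

      to : mis G ≡ 2 ^ ∣ C ∣ → ExtendsEverySubset C
      to mis≡ A A⊆C = All.lookup all-extendable (∈-subsetsOf⁺ A⊆C)
        where
        all-extendable : All (MaximalIndependent G ∘ extension C) subsets
        all-extendable = subst (All _) (filter-complete extendable? (begin
          length (filter extendable? subsets) ≡⟨ sym mis≡#extendable ⟩
          mis G                               ≡⟨ mis≡ ⟩
          2 ^ ∣ C ∣                           ≡⟨ sym (length-subsetsOf C) ⟩
          length subsets                      ∎)) (all-filter extendable? subsets)

      from : ExtendsEverySubset C → mis G ≡ 2 ^ ∣ C ∣
      from extends = begin
        mis G                               ≡⟨ mis≡#extendable ⟩
        length (filter extendable? subsets) ≡⟨ cong length (filter-all extendable? all-extendable) ⟩
        length subsets                      ≡⟨ length-subsetsOf C ⟩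
        2 ^ ∣ C ∣                           ∎
        where
        all-extendable : All (MaximalIndependent G ∘ extension C) subsets
        all-extendable = All.tabulate λ {A} A∈ → extends A (∈-subsetsOf⁻ A∈)

  PrivateNeighbours : Subset n → Set
  PrivateNeighbours C = ∀ c → c ∈ C → ∃[ w ] Adj c w × w ∉ C × (∀ u → u ∈ C → Adj w u → u ≡ c)

  PrivateCover : Subset n → Set
  PrivateCover C = VertexCover G C × Independent G C × PrivateNeighbours C

  module _ {C : Subset n} (C-cover : VertexCover G C) where

    extendsEverySubset⇒independent : ExtendsEverySubset C → Independent G C
    extendsEverySubset⇒independent extends u v u∈C v∈C =
      proj₁ (extends C (λ x∈C → x∈C)) u v (C⊆extension u∈C) (C⊆extension v∈C)
      where
      C⊆extension : C ⊆ extension C C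
      C⊆extension x∈C = ∈-subset⁺ (inExtension? C C) (inj₁ (x∈C , x∈C))

    -- The private neighbour of c is a vertex dominating c in the extension of C - c.
    extendsEverySubset⇒private : ExtendsEverySubset C → PrivateNeighbours C
    extendsEverySubset⇒private extends c c∈C =
      w , cw , w∉C , λ u u∈C wu → decidable-stable (u ≟ c) λ u≢c →
        w-no-neighbour u (∈-subset⁺ C-c? (u∈C , u≢c)) wu
      where
      C-c? : Decidable (λ u → u ∈ C × u ≢ c)
      C-c? u = (u ∈? C) ×-dec ¬? (u ≟ c)

      c∉extension : c ∉ extension C (subset C-c?)
      c∉extension c∈E with ∈-subset⁻ (inExtension? C (subset C-c?)) c∈E
      ... | inj₁ (_ , c∈C-c) = proj₂ (∈-subset⁻ C-c? c∈C-c) refl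
      ... | inj₂ (c∉C , _)   = c∉C c∈C

      dominating : ∃[ w ] w ∈ extension C (subset C-c?) × Adj c w
      dominating = maximal⇒dominating (extends (subset C-c?) (proj₁ ∘ ∈-subset⁻ C-c?)) c c∉extension

      w : Fin n
      w = proj₁ dominating

      cw : Adj c w
      cw = proj₂ (proj₂ dominating)

      w∉C : w ∉ C
      w∉C w∈C = extendsEverySubset⇒independent extends c w c∈C w∈C cw

      w-no-neighbour : ∀ u → u ∈ subset C-c? → ¬ Adj w u
      w-no-neighbour with ∈-subset⁻ (inExtension? C (subset C-c?)) (proj₁ (proj₂ dominating))
      ... | inj₁ (w∈C , _)      = contradiction w∈C w∉C
      ... | inj₂ (_ , no-neighbour) = no-neighbour

    independent∧private⇒extendsEverySubset : Independent G C → PrivateNeighbours C → ExtendsEverySubset C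
    independent∧private⇒extendsEverySubset C-indep C-private A A⊆C =
      independent∧dominating⇒maximal E-independent E-dominating
      where
      E : Subset n
      E = extension C A

      E? : Decidable (InExtension C A)
      E? = inExtension? C A

      E-independent : Independent G E
      E-independent u v u∈E v∈E uv with ∈-subset⁻ E? u∈E | ∈-subset⁻ E? v∈E
      ... | inj₁ (u∈C , _)  | inj₁ (v∈C , _)          = C-indep u v u∈C v∈C uv
      ... | inj₁ (_ , u∈A)  | inj₂ (_ , no-neighbour) = no-neighbour u u∈A (adj-sym uv)
      ... | inj₂ (_ , no-neighbour) | inj₁ (_ , v∈A)  = no-neighbour v v∈A uv
      ... | inj₂ (u∉C , _)  | inj₂ (v∉C , _)          = [ u∉C , v∉C ] (C-cover u v uv)

      E-dominating : Dominating E
      E-dominating v v∉E with v ∈? C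
      ... | yes v∈C =
        let (w , vw , w∉C , w-private) = C-private v v∈C
            v∉A : v ∉ A
            v∉A v∈A = v∉E (∈-subset⁺ E? (inj₁ (v∈C , v∈A)))
            w-no-neighbour : ∀ u → u ∈ A → ¬ Adj w u
            w-no-neighbour u u∈A wu = v∉A (subst (_∈ A) (w-private u (A⊆C u∈A) wu) u∈A)
        in w , ∈-subset⁺ E? (inj₂ (w∉C , w-no-neighbour)) , vw
      ... | no v∉C with any? (λ u → (u ∈? A) ×-dec adj? v u)
      ...   | yes (u , u∈A , vu) = u , ∈-subset⁺ E? (inj₁ (A⊆C u∈A , u∈A)) , vu
      ...   | no ¬neighbour      =
        contradiction (∈-subset⁺ E? (inj₂ (v∉C , λ u u∈A vu → ¬neighbour (u , u∈A , vu)))) v∉E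

    mis≡2^∣C∣⇔independent×private : (mis G ≡ 2 ^ ∣ C ∣) ⇔ (Independent G C × PrivateNeighbours C)
    mis≡2^∣C∣⇔independent×private = mk⇔
      (λ mis≡ → let extends = Equivalence.to (mis≡2^∣C∣⇔extendsEverySubset C-cover) mis≡ in
        extendsEverySubset⇒independent extends , extendsEverySubset⇒private extends)
      (λ (C-indep , C-private) → Equivalence.from (mis≡2^∣C∣⇔extendsEverySubset C-cover)
        (independent∧private⇒extendsEverySubset C-indep C-private))

    privateCover⇒inducedMatching : Independent G C → PrivateNeighbours C →
      Σ (Fin ∣ C ∣ → Fin n × Fin n) (IsInducedMatching G ∣ C ∣)
    privateCover⇒inducedMatching C-indep C-private = e , inducedMatching-intro cw touch⇒same
      where
      c : Fin ∣ C ∣ → Fin n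
      c = enumerate C

      c∈C : ∀ i → c i ∈ C
      c∈C = enumerate-∈ C

      w : Fin ∣ C ∣ → Fin n
      w i = proj₁ (C-private (c i) (c∈C i))

      cw : ∀ i → Adj (c i) (w i)
      cw i = proj₁ (proj₂ (C-private (c i) (c∈C i)))

      w∉C : ∀ i → w i ∉ C
      w∉C i = proj₁ (proj₂ (proj₂ (C-private (c i) (c∈C i))))

      w-private : ∀ i u → u ∈ C → Adj (w i) u → u ≡ c i
      w-private i = proj₂ (proj₂ (proj₂ (C-private (c i) (c∈C i))))

      e : Fin ∣ C ∣ → Fin n × Fin n
      e i = c i , w i

      touch⇒same : ∀ {i j x y} → Endpoint G x (e i) → Endpoint G y (e j) → Touch x y → i ≡ j
      touch⇒same {i} {j} (inj₁ refl) (inj₁ refl) (inj₁ eq) = enumerate-injective C eq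
      touch⇒same {i} {j} (inj₁ refl) (inj₁ refl) (inj₂ cc) = ⊥-elim (C-indep _ _ (c∈C i) (c∈C j) cc)
      touch⇒same {i} {j} (inj₁ refl) (inj₂ refl) (inj₁ eq) =
        contradiction (subst (_∈ C) eq (c∈C i)) (w∉C j)
      touch⇒same {i} {j} (inj₁ refl) (inj₂ refl) (inj₂ cw′) =
        enumerate-injective C (w-private j (c i) (c∈C i) (adj-sym cw′))
      touch⇒same {i} {j} (inj₂ refl) (inj₁ refl) (inj₁ eq) =
        contradiction (subst (_∈ C) (sym eq) (c∈C j)) (w∉C i)
      touch⇒same {i} {j} (inj₂ refl) (inj₁ refl) (inj₂ wc) =
        sym (enumerate-injective C (w-private i (c j) (c∈C j) wc))
      touch⇒same {i} {j} (inj₂ refl) (inj₂ refl) (inj₁ eq) =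
        sym (enumerate-injective C
          (w-private i (c j) (c∈C j) (subst (λ z → Adj z (c j)) (sym eq) (adj-sym (cw j)))))
      touch⇒same {i} {j} (inj₂ refl) (inj₂ refl) (inj₂ ww) = ⊥-elim ([ w∉C i , w∉C j ] (C-cover _ _ ww))

    privateCover-minimum : Independent G C → PrivateNeighbours C →
      ∀ {D} → VertexCover G D → ∣ C ∣ ≤ ∣ D ∣
    privateCover-minimum C-indep C-private =
      matching≤cover (proj₁ (proj₂ (privateCover⇒inducedMatching C-indep C-private)))

    privateCover⇒cameronWalker : Independent G C → PrivateNeighbours C → CameronWalker G
    privateCover⇒cameronWalker C-indep C-private a a₀ ((_ , f-matching) , a-max) ((g , g-induced) , a₀-max) =
      ≤-antisym (≤-trans (matching≤cover f-matching C-cover) (a₀-max ∣ C ∣ (proj₁ C-matching) (proj₂ C-matching)))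
                (a-max a₀ g (proj₁ g-induced))
      where
      C-matching : Σ (Fin ∣ C ∣ → Fin n × Fin n) (IsInducedMatching G ∣ C ∣)
      C-matching = privateCover⇒inducedMatching C-indep C-private

    independentCover⇒bipartite : Independent G C → Bipartite G
    independentCover⇒bipartite C-indep =
      (λ v → does (v ∈? C)) , λ u v uv → differ uv (u ∈? C) (v ∈? C)
      where
      differ : ∀ {u v} → Adj u v → (u∈? : Dec (u ∈ C)) (v∈? : Dec (v ∈ C)) → does u∈? ≢ does v∈?
      differ uv (yes u∈C) (yes v∈C) _ = C-indep _ _ u∈C v∈C uv
      differ uv (no u∉C)  (no v∉C)  _ = [ u∉C , v∉C ] (C-cover _ _ uv)
      differ uv (yes _)   (no _)    ()
      differ uv (no _)    (yes _)   ()

  module _ {k : ℕ} where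

    matching-∷ : ∀ {e} → IsMatching G k e → ∀ {x y} → Adj x y → ¬ Covered e x → ¬ Covered e y →
      IsMatching G (suc k) ((x , y) VF.∷ e)
    matching-∷ {e} (edges , disjoint) {x} {y} xy x-free y-free = edges′ , disjoint′
      where
      edges′ : ∀ i → Adj (proj₁ (((x , y) VF.∷ e) i)) (proj₂ (((x , y) VF.∷ e) i))
      edges′ zero    = xy
      edges′ (suc i) = edges i

      new-free : ∀ {w} j → Endpoint G w (x , y) → ¬ Endpoint G w (e j)
      new-free j (inj₁ refl) w∈j = x-free (j , w∈j)
      new-free j (inj₂ refl) w∈j = y-free (j , w∈j)

      disjoint′ : ∀ i j → i ≢ j → ∀ w →
        Endpoint G w (((x , y) VF.∷ e) i) → ¬ Endpoint G w (((x , y) VF.∷ e) j)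
      disjoint′ zero    zero    i≢j = contradiction refl i≢j
      disjoint′ zero    (suc j) _   w w∈0 w∈j = new-free j w∈0 w∈j
      disjoint′ (suc i) zero    _   w w∈i w∈0 = new-free i w∈0 w∈i
      disjoint′ (suc i) (suc j) i≢j = disjoint i j (i≢j ∘ cong suc)

    endpoint-updateAt : ∀ (e : Fin k → Fin n × Fin n) i a j {w} →
      Endpoint G w (updateAt e i (const a) j) →
      (j ≡ i × Endpoint G w a) ⊎ (j ≢ i × Endpoint G w (e j))
    endpoint-updateAt e i a j {w} w∈j with j ≟ i
    ... | yes refl = inj₁ (refl , subst (Endpoint G w) (updateAt-updates i e) w∈j)
    ... | no j≢i   = inj₂ (j≢i , subst (Endpoint G w) (updateAt-minimal j i e j≢i) w∈j)

    matching-updateAt : ∀ {e} → IsMatching G k e → ∀ i {a} → Adj (proj₁ a) (proj₂ a) →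
      (∀ j → j ≢ i → ∀ w → Endpoint G w a → ¬ Endpoint G w (e j)) →
      IsMatching G k (updateAt e i (const a))
    matching-updateAt {e} (edges , disjoint) i {a} a-edge a-free = edges′ , disjoint′
      where
      edges′ : ∀ j → Adj (proj₁ (updateAt e i (const a) j)) (proj₂ (updateAt e i (const a) j))
      edges′ j with j ≟ i
      ... | yes refl = subst (λ b → Adj (proj₁ b) (proj₂ b)) (sym (updateAt-updates i e)) a-edge
      ... | no j≢i   = subst (λ b → Adj (proj₁ b) (proj₂ b)) (sym (updateAt-minimal j i e j≢i)) (edges j)

      disjoint′ : ∀ j j′ → j ≢ j′ → ∀ w → Endpoint G w (updateAt e i (const a) j) →
        ¬ Endpoint G w (updateAt e i (const a) j′)
      disjoint′ j j′ j≢j′ w w∈j w∈j′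
        with endpoint-updateAt e i a j w∈j | endpoint-updateAt e i a j′ w∈j′
      ... | inj₁ (refl , _)     | inj₁ (refl , _)       = j≢j′ refl
      ... | inj₁ (refl , w∈a)   | inj₂ (j′≢i , w∈ej′)   = a-free j′ j′≢i w w∈a w∈ej′
      ... | inj₂ (j≢i , w∈ej)   | inj₁ (refl , w∈a)     = a-free j j≢i w w∈a w∈ej
      ... | inj₂ (_ , w∈ej)     | inj₂ (_ , w∈ej′)      = disjoint j j′ j≢j′ w w∈ej w∈ej′

    module _ {e : Fin k → Fin n × Fin n} (matching : IsMatching G k e) (maximum : MatchingsAtMost k) where

      maximum⇒covers : ∀ {u v} → Adj u v → Covered e u ⊎ Covered e v
      maximum⇒covers {u} {v} uv with covered? e u | covered? e v
      ... | yes u-covered | _             = inj₁ u-covered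
      ... | no _          | yes v-covered = inj₂ v-covered
      ... | no u-free     | no v-free     =
        contradiction (maximum (suc k) _ (matching-∷ matching uv u-free v-free)) 1+n≰n

      -- For v ≢ w, v p q w is an augmenting path: replace pq by pv and add qw.
      maximum⇒no-augmenting-path : ∀ i {v w} → Adj v (proj₁ (e i)) → Adj (proj₂ (e i)) w →
        ¬ Covered e v → ¬ Covered e w → v ≡ w
      maximum⇒no-augmenting-path i {v} {w} vp qw v-free w-free = decidable-stable (v ≟ w) λ v≢w →
        contradiction (maximum (suc k) _ (matching-∷ swapped qw q-free (w-free′ v≢w))) 1+n≰n
        where
        p q : Fin n
        p = proj₁ (e i)
        q = proj₂ (e i)

        e′ : Fin k → Fin n × Fin n
        e′ = updateAt e i (const (p , v))

        pv-free : ∀ j → j ≢ i → ∀ z → Endpoint G z (p , v) → ¬ Endpoint G z (e j)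
        pv-free j j≢i z (inj₁ refl) z∈j = j≢i (sym (shared-endpoint⇒same-edge matching (inj₁ refl) z∈j))
        pv-free j j≢i z (inj₂ refl) z∈j = v-free (j , z∈j)

        swapped : IsMatching G k e′
        swapped = matching-updateAt matching i (adj-sym vp) pv-free

        q-free : ¬ Covered e′ q
        q-free (j , q∈j) with endpoint-updateAt e i (p , v) j q∈j
        ... | inj₁ (refl , inj₁ q≡p) = irrefl (subst (Adj p) q≡p (proj₁ matching i))
        ... | inj₁ (refl , inj₂ refl) = v-free (i , inj₂ refl)
        ... | inj₂ (j≢i , q∈ej)      = j≢i (sym (shared-endpoint⇒same-edge matching (inj₂ refl) q∈ej))

        w-free′ : v ≢ w → ¬ Covered e′ w
        w-free′ v≢w (j , w∈j) with endpoint-updateAt e i (p , v) j w∈j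
        ... | inj₁ (refl , inj₁ refl) = w-free (i , inj₁ refl)
        ... | inj₁ (refl , inj₂ refl) = v≢w refl
        ... | inj₂ (_ , w∈ej)         = w-free (j , w∈ej)

  bipartite⇒triangle-free : Bipartite G → ∀ {x y z} → Adj x y → Adj y z → Adj z x → ⊥
  bipartite⇒triangle-free (colour , proper) {x} {y} {z} xy yz zx = proper z x zx (begin
    colour z             ≡⟨ ¬-not (proper z y (adj-sym yz)) ⟩
    not (colour y)       ≡⟨ cong not (¬-not (proper y x (adj-sym xy))) ⟩
    not (not (colour x)) ≡⟨ not-involutive (colour x) ⟩
    colour x             ∎)
    where open ≡-Reasoning

  data Reoriented (a : Fin n × Fin n) : Fin n × Fin n → Set where
    as-is   : Reoriented a a
    flipped : Reoriented a (swap a)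

  reoriented-endpoint : ∀ {a b w} → Reoriented a b → Endpoint G w a → Endpoint G w b
  reoriented-endpoint as-is   = λ w∈a → w∈a
  reoriented-endpoint flipped = Data.Sum.swap

  reoriented-sym : ∀ {a b} → Reoriented a b → Reoriented b a
  reoriented-sym as-is   = as-is
  reoriented-sym flipped = flipped

  reoriented-adj : ∀ {a b} → Reoriented a b → Adj (proj₁ a) (proj₂ a) → Adj (proj₁ b) (proj₂ b)
  reoriented-adj as-is   = λ ab → ab
  reoriented-adj flipped = adj-sym

  module _ {k : ℕ} {e e′ : Fin k → Fin n × Fin n} (reoriented : ∀ i → Reoriented (e i) (e′ i)) where

    reoriented-covered : ∀ {w} → Covered e w → Covered e′ w
    reoriented-covered (i , w∈i) = i , reoriented-endpoint (reoriented i) w∈i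

    reoriented-inducedMatching : IsInducedMatching G k e → IsInducedMatching G k e′
    reoriented-inducedMatching induced = inducedMatching-intro
      (λ i → reoriented-adj (reoriented i) (proj₁ (proj₁ induced) i))
      (λ x∈i y∈j → touching⇒same-edge induced (back x∈i) (back y∈j))
      where
      back : ∀ {i w} → Endpoint G w (e′ i) → Endpoint G w (e i)
      back {i} = reoriented-endpoint (reoriented-sym (reoriented i))

  module _ {k : ℕ} {e : Fin k → Fin n × Fin n} (induced : IsInducedMatching G k e)
    (covers : ∀ {u v} → Adj u v → Covered e u ⊎ Covered e v)
    (saturated : ∀ i {w} → Adj (proj₂ (e i)) w → Covered e w) where

    private
      first? : Decidable (λ v → ∃[ i ] v ≡ proj₁ (e i))
      first? v = any? λ i → v ≟ proj₁ (e i)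

      edge : ∀ i → Adj (proj₁ (e i)) (proj₂ (e i))
      edge = proj₁ (proj₁ induced)

    firstEnds : Subset n
    firstEnds = subset first?

    private
      first∈ : ∀ i → proj₁ (e i) ∈ firstEnds
      first∈ i = ∈-subset⁺ first? (i , refl)

      covered-end : ∀ {u v} → Covered e u → Adj u v → u ∈ firstEnds ⊎ v ∈ firstEnds
      covered-end (i , inj₁ refl) uv = inj₁ (first∈ i)
      covered-end (i , inj₂ refl) uv with saturated i uv
      ... | j , v∈j with refl ← touching⇒same-edge induced (inj₂ refl) v∈j (inj₂ uv) with v∈j
      ...   | inj₁ refl = inj₂ (first∈ i)
      ...   | inj₂ refl = ⊥-elim (irrefl uv)

    firstEnds-cover : VertexCover G firstEnds
    firstEnds-cover u v uv with covers uv
    ... | inj₁ u-covered = covered-end u-covered uv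
    ... | inj₂ v-covered = Data.Sum.swap (covered-end v-covered (adj-sym uv))

    firstEnds-independent : Independent G firstEnds
    firstEnds-independent u v u∈ v∈ uv with ∈-subset⁻ first? u∈ | ∈-subset⁻ first? v∈
    ... | i , refl | j , refl
      with refl ← touching⇒same-edge induced (inj₁ refl) (inj₁ refl) (inj₂ uv) = irrefl uv

    firstEnds-private : PrivateNeighbours firstEnds
    firstEnds-private c c∈ with ∈-subset⁻ first? c∈
    ... | i , refl = proj₂ (e i) , edge i , second∉ , second-private
      where
      second∉ : proj₂ (e i) ∉ firstEnds
      second∉ q∈ with ∈-subset⁻ first? q∈
      ... | j , q≡p with refl ← touching⇒same-edge induced (inj₂ refl) (inj₁ refl) (inj₁ q≡p) =
        irrefl (subst (Adj (proj₁ (e i))) q≡p (edge i))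

      second-private : ∀ u → u ∈ firstEnds → Adj (proj₂ (e i)) u → u ≡ proj₁ (e i)
      second-private u u∈ qu with ∈-subset⁻ first? u∈
      ... | j , refl with refl ← touching⇒same-edge induced (inj₂ refl) (inj₁ refl) (inj₂ qu) = refl

  module _ (bipartite : Bipartite G) {k : ℕ} {e : Fin k → Fin n × Fin n}
    (induced : IsInducedMatching G k e) (maximum : MatchingsAtMost k) where

    private
      matching : IsMatching G k e
      matching = proj₁ induced

      -- If q has an unmatched neighbour w₀ the edge is flipped: an unmatched neighbour w
      -- of p would close the triangle p q w₀ (w = w₀) or give an augmenting path.
      orient : ∀ i → ∃[ a ] Reoriented (e i) a × (∀ {w} → Adj (proj₂ a) w → Covered e w)
      orient i with any? (λ w → adj? (proj₂ (e i)) w ×-dec ¬? (covered? e w))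
      ... | no no-free-neighbour = e i , as-is , λ {w} qw →
        decidable-stable (covered? e w) λ w-free → no-free-neighbour (w , qw , w-free)
      ... | yes (w₀ , qw₀ , w₀-free) = swap (e i) , flipped , λ {w} pw →
        decidable-stable (covered? e w) λ w-free →
          bipartite⇒triangle-free bipartite (proj₁ matching i) qw₀
            (subst (λ z → Adj z (proj₁ (e i)))
              (maximum⇒no-augmenting-path matching maximum i (adj-sym pw) qw₀ w-free w₀-free) (adj-sym pw))

      e′ : Fin k → Fin n × Fin n
      e′ i = proj₁ (orient i)

      reoriented : ∀ i → Reoriented (e i) (e′ i)
      reoriented i = proj₁ (proj₂ (orient i))

      induced′ : IsInducedMatching G k e′
      induced′ = reoriented-inducedMatching reoriented induced

      covers′ : ∀ {u v} → Adj u v → Covered e′ u ⊎ Covered e′ v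
      covers′ = Data.Sum.map (reoriented-covered reoriented) (reoriented-covered reoriented)
        ∘ maximum⇒covers matching maximum

      saturated′ : ∀ i {w} → Adj (proj₂ (e′ i)) w → Covered e′ w
      saturated′ i = reoriented-covered reoriented ∘ proj₂ (proj₂ (orient i))

    inducedMaximumMatching⇒privateCover : ∃[ C ] PrivateCover C
    inducedMaximumMatching⇒privateCover =
      firstEnds induced′ covers′ saturated′ ,
      firstEnds-cover induced′ covers′ saturated′ ,
      firstEnds-independent induced′ covers′ saturated′ ,
      firstEnds-private induced′ covers′ saturated′

  ⊤-cover : VertexCover G ⊤
  ⊤-cover _ _ _ = inj₁ ∈⊤

  HasMatching HasInducedMatching : ℕ → Set
  HasMatching j = Σ (Fin j → Fin n × Fin n) (IsMatching G j)
  HasInducedMatching j = Σ (Fin j → Fin n × Fin n) (IsInducedMatching G j)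

  hasMatching⇒≤n : ∀ j → HasMatching j → j ≤ n
  hasMatching⇒≤n j (_ , matching) = subst (j ≤_) (∣⊤∣≡n n) (matching≤cover matching ⊤-cover)

  ¬¬-matchingNumber : ¬ ¬ (∃[ a ] IsMatchingNumber G a)
  ¬¬-matchingNumber =
    ¬¬-map (λ (a , witness , maximum) → a , witness , λ j f m → maximum j (f , m))
    (¬¬-maximum HasMatching ((λ ()) , (λ ()) , (λ ())) n hasMatching⇒≤n)

  ¬¬-inducedMatchingNumber : ¬ ¬ (∃[ a₀ ] IsInducedMatchingNumber G a₀)
  ¬¬-inducedMatchingNumber =
    ¬¬-map (λ (a₀ , witness , maximum) → a₀ , witness , λ j f m → maximum j (f , m))
    (¬¬-maximum HasInducedMatching ((λ ()) , ((λ ()) , (λ ())) , (λ ())) n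
      (λ j (f , induced) → hasMatching⇒≤n j (f , proj₁ induced)))

  cameronWalker⇒¬¬inducedMaximumMatching : CameronWalker G → ¬ ¬ InducedMaximumMatching
  cameronWalker⇒¬¬inducedMaximumMatching cameronWalker none =
    ¬¬-matchingNumber λ (a , ν) →
    ¬¬-inducedMatchingNumber λ (a₀ , ν₀@((g , g-induced) , _)) →
    none (a₀ , g , g-induced , λ j f m → subst (j ≤_) (cameronWalker a a₀ ν ν₀) (proj₂ ν j f m))

  bipartite∧cameronWalker⇒¬¬privateCover : Bipartite G → CameronWalker G → ¬ ¬ (∃[ C ] PrivateCover C)
  bipartite∧cameronWalker⇒¬¬privateCover bipartite cameronWalker =
    ¬¬-map (λ (_ , _ , induced , maximum) → inducedMaximumMatching⇒privateCover bipartite induced maximum)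
      (cameronWalker⇒¬¬inducedMaximumMatching cameronWalker)

theorem3p3 : ∀ {n : ℕ} (G : Graph n) (b : ℕ) → IsVertexCoverNumber G b →
    (mis G ≡ 2 ^ b) ⇔ (Bipartite G × CameronWalker G)
theorem3p3 G b ((C , C-cover , ∣C∣≡b) , C-minimum) = mk⇔ forward backward
  where
  mis≡2^b⇔independent×private : (mis G ≡ 2 ^ b) ⇔ (Independent G C × PrivateNeighbours G C)
  mis≡2^b⇔independent×private =
    subst (λ m → (mis G ≡ 2 ^ m) ⇔ _) ∣C∣≡b (mis≡2^∣C∣⇔independent×private G C-cover)

  forward : mis G ≡ 2 ^ b → Bipartite G × CameronWalker G
  forward mis≡2^b =
    let (C-indep , C-private) = Equivalence.to mis≡2^b⇔independent×private mis≡2^b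
    in independentCover⇒bipartite G C-cover C-indep , privateCover⇒cameronWalker G C-cover C-indep C-private

  fromPrivateCover : ∃[ D ] PrivateCover G D → mis G ≡ 2 ^ b
  fromPrivateCover (D , D-cover , D-indep , D-private) = begin
    mis G      ≡⟨ Equivalence.from (mis≡2^∣C∣⇔independent×private G D-cover) (D-indep , D-private) ⟩
    2 ^ ∣ D ∣  ≡⟨ cong (2 ^_) (≤-antisym ∣D∣≤b (C-minimum D D-cover)) ⟩
    2 ^ b      ∎
    where
    open ≡-Reasoning
    ∣D∣≤b : ∣ D ∣ ≤ b
    ∣D∣≤b = subst (∣ D ∣ ≤_) ∣C∣≡b (privateCover-minimum G D-cover D-indep D-private C-cover)

  -- ν(G) and ν₀(G) exist only under double negation, which the decidable goal absorbs.
  backward : Bipartite G × CameronWalker G → mis G ≡ 2 ^ b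
  backward (bipartite , cameronWalker) = decidable-stable (mis G ℕ.≟ 2 ^ b)
    (¬¬-map fromPrivateCover (bipartite∧cameronWalker⇒¬¬privateCover G bipartite cameronWalker))
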